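{- Let $\mathbf A$ be a finite Boolean algebra and $P$ a conditional probability on $A\times A'$. Let $t,t'\in\mathbb{T}(A)$ be such that $\mathbf b(t)=\mathbf b(t')$ (as events of $\mathbf A$) and $X_t(w)=X_{t'}(w)$ for every $w\in\Omega$ with $w\models\mathbf b(t)$. Then $X_t=X_{t'}$.
   Context: $\mathbf A=(A,\wedge,\vee,\neg,\bot,\top)$ is a finite Boolean algebra; write $ab$ for $a\wedge b$, $\bar a$ for $\neg a$, and $A'=A\setminus\{\bot\}$. $\Omega$ is the set of Boolean homomorphisms $w:\mathbf A\to\{0,1\}$ (identified with the atoms of $\mathbf A$); $w\models a$ means $w(a)=1$. A basic conditional is a pair $(a\mid b)$ with $a\in A$, $b\in A'$. $\mathbb{T}(A)$ is the set of terms built from basic conditionals (as variables) and constants $0,1$ using $\neg,\wedge,\vee$. For a term $t$, $\mathbf b(t)$ is the disjunction of the antecedents of the basic conditionals occurring in $t$ ($\mathbf b(t)=\top$ if $t\in\{0,1\}$). For $w\in\Omega$ the $w$-reduct $t^w$ is obtained by replacing each occurring $(a_i\mid b_i)$ by $1$ if $w\models a_ib_i$, by $0$ if $w\models\bar a_ib_i$ (unchanged if $w\models\bar b_i$), then applying $\neg1:=0$, $\neg0:=1$, $r\wedge1=1\wedge r:=r$, $r\wedge0=0\wedge r:=0$, $r\vee1=1\vee r:=1$, $r\vee0=0\vee r:=r$ to subterms until no rule applies. A conditional probability on $A\times A'$ is $P:A\times A'\to[0,1]$ with $P(\cdot\mid b)$ a finitely additive probability on $\mathbf A$ for each $b\in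 A'$, $P(b\mid b)=1$, and $P(ab\mid c)=P(a\mid bc)P(b\mid c)$. For $X:\Omega\to\mathbb R$, $\mathbb P(X\mid b)=\sum_{w}X(w)P(w\mid b)$. Given $P$, $X_t:\Omega\to[0,1]$ is defined recursively by $X_1\equiv1$, $X_0\equiv0$, $X_t(w)=\mathbb P(X_{t^w}\mid\mathbf b(t^w))$; for $w\models\neg\mathbf b(t)$, $t^w=t$ and $X_t(w)=\mathbb P(X_t\mid\mathbf b(t))$, a value depending only on $X_t$ at worlds satisfying $\mathbf b(t)$. -}

module Defs where

open import Level using (Level; _⊔_)
open import Data.Nat as ℕ using (ℕ; zero; suc)
open import Data.Fin using (Fin)
open import Data.Fin.Subset using (Subset; _∈_; _∉_; _∩_; _∪_; ∁; ⁅_⁆; Nonempty)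
  renaming (⊥ to ∅; ⊤ to full)
open import Data.Fin.Subset.Properties using (_∈?_)
open import Relation.Nullary using (yes; no)
open import Relation.Binary.PropositionalEquality using (_≡_)
open import Data.Product using (_×_)
open import Algebra.Bundles using (CommutativeRing)

-- The finite Boolean algebra A is represented (up to isomorphism) as the
-- power set of its (finitely many, n) atoms: events are  Subset n,
-- worlds w ∈ Ω are atoms  Fin n, and  w ⊨ a  is  w ∈ a.
-- ⊥ = ∅, ⊤ = full, ab = a ∩ b, a ∨ b = a ∪ b, ā = ∁ a.
-- A' = nonempty events.

Event : ℕ → Set
Event n = Subset n

World : ℕ → Set
World n = Fin n

data Term (n : ℕ) : Set where
  cond : (a b : Event n) → Nonempty b → Term n
  𝟘 𝟙  : Term n
  ¬ᵗ_  : Term n → Term n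
  _∧ᵗ_ : Term n → Term n → Term n
  _∨ᵗ_ : Term n → Term n → Term n

antecedents : ∀ {n} → Term n → Event n
antecedents (cond a b _) = b
antecedents 𝟘 = ∅
antecedents 𝟙 = ∅
antecedents (¬ᵗ t) = antecedents t
antecedents (t ∧ᵗ s) = antecedents t ∪ antecedents s
antecedents (t ∨ᵗ s) = antecedents t ∪ antecedents s

𝐛 : ∀ {n} → Term n → Event n
𝐛 𝟘 = full
𝐛 𝟙 = full
𝐛 t = antecedents t

-- Simplification rules (applied bottom-up, which yields the normal form
-- w.r.t. the rules  ¬1:=0, ¬0:=1, r∧1=1∧r:=r, r∧0=0∧r:=0, r∨1=1∨r:=1,
-- r∨0=0∨r:=r).
neg : ∀ {n} → Term n → Term n
neg 𝟙 = 𝟘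
neg 𝟘 = 𝟙
neg t = ¬ᵗ t

conj : ∀ {n} → Term n → Term n → Term n
conj 𝟘 s = 𝟘
conj 𝟙 s = s
conj t 𝟘 = 𝟘
conj t 𝟙 = t
conj t s = t ∧ᵗ s

disj : ∀ {n} → Term n → Term n → Term n
disj 𝟙 s = 𝟙
disj 𝟘 s = s
disj t 𝟙 = 𝟙
disj t 𝟘 = t
disj t s = t ∨ᵗ s

reduct : ∀ {n} → World n → Term n → Term n
reduct w (cond a b p) with w ∈? (a ∩ b)
... | yes _ = 𝟙
... | no _ with w ∈? (∁ a ∩ b)
...   | yes _ = 𝟘
...   | no _ = cond a b p
reduct w 𝟘 = 𝟘
reduct w 𝟙 = 𝟙
reduct w (¬ᵗ t) = neg (reduct w t)
reduct w (t ∧ᵗ s) = conj (reduct w t) (reduct w s)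
reduct w (t ∨ᵗ s) = disj (reduct w t) (reduct w s)

count : ∀ {n} → Term n → ℕ
count (cond _ _ _) = 1
count 𝟘 = 0
count 𝟙 = 0
count (¬ᵗ t) = count t
count (t ∧ᵗ s) = count t ℕ.+ count s
count (t ∨ᵗ s) = count t ℕ.+ count s

module _ {c ℓ : Level} (R : CommutativeRing c ℓ) where
  open CommutativeRing R

  Σ : ∀ {n} → (Fin n → Carrier) → Carrier
  Σ {zero} f = 0#
  Σ {suc n} f = f Fin.zero + Σ (λ i → f (Fin.suc i))
    where import Data.Fin as Fin

  -- P is given as a function on all pairs, but all
  -- axioms (and all uses) concern only nonempty conditioning events.
  record IsConditionalProbability {ℓ'} (_≤_ : Carrier → Carrier → Set ℓ')
         {n : ℕ} (P : Event n → Event n → Carrier) : Set (c ⊔ ℓ ⊔ ℓ') where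
    field
      range     : ∀ a b → Nonempty b → (0# ≤ P a b) × (P a b ≤ 1#)
      normed    : ∀ b → Nonempty b → P full b ≈ 1#
      additive  : ∀ a a' b → Nonempty b → a ∩ a' ≡ ∅ →
                  P (a ∪ a') b ≈ P a b + P a' b
      self      : ∀ b → Nonempty b → P b b ≈ 1#
      chain     : ∀ a b c' → Nonempty c' → Nonempty (b ∩ c') →
                  P (a ∩ b) c' ≈ P a (b ∩ c') * P b c'
    
  module _ {n : ℕ} (P : Event n → Event n → Carrier) where

    𝐄 : (World n → Carrier) → Event n → Carrier
    𝐄 X b = Σ (λ w → X w * P ⁅ w ⁆ b)

    -- Σ restricted to worlds satisfying b (used for 𝐏(X_t ∣ 𝐛(t)) when
    -- w ⊨ ¬𝐛(t): only the values of X_t on 𝐛(t) matter, P(v ∣ 𝐛 t) = 0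
    -- for v ⊭ 𝐛 t).
    𝐄on : (World n → Carrier) → Event n → Carrier
    𝐄on X b = Σ (λ v → restrict v)
      where
      restrict : World n → Carrier
      restrict v with v ∈? b
      ... | yes _ = X v * P ⁅ v ⁆ b
      ... | no _  = 0#

    -- X_t with explicit fuel (recursion depth); X below supplies enough
    -- fuel (count t + 1), since every reduct t^w with w ⊨ 𝐛(t) has strictly
    -- fewer basic-conditional occurrences than t.
    Xf : ℕ → Term n → World n → Carrier
    Xf _ 𝟙 w = 1#
    Xf _ 𝟘 w = 0#
    Xf zero t w = 0#
    Xf (suc k) t w with w ∈? 𝐛 t
    ... | yes _ = inner w
      where
      inner : World n → Carrier
      inner v = 𝐄 (Xf k (reduct v t)) (𝐛 (reduct v t))
    ... | no _  = 𝐄on inner (𝐛 t)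
      where
      inner : World n → Carrier
      inner v = 𝐄 (Xf k (reduct v t)) (𝐛 (reduct v t))

    X : Term n → World n → Carrier
    X t = Xf (suc (count t)) t

{-# OPTIONS --safe #-}
module Submission where

open import Defs
open import Level using (Level)
open import Data.Nat using (ℕ; zero; suc)
open import Data.Fin using (Fin)
import Data.Fin as Fin
open import Data.Fin.Subset using (_∈_; _∉_)
open import Data.Fin.Subset.Properties using (_∈?_; ∈⊤)
open import Data.Product using (_,_; proj₁; proj₂)
open import Relation.Nullary using (yes; no; contradiction)
open import Relation.Nullary.Decidable using (dec-yes; dec-no)
open import Relation.Binary.PropositionalEquality as ≡ using (_≡_)
open import Algebra.Bundles using (CommutativeRing)
import Relation.Binary.Reasoning.Setoid as SetoidReasoning

-- Outside 𝐛(t) the defining recursion gives X_t(w) = 𝐏(X_t ∣ 𝐛(t)), an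
-- expectation that only sees the values of X_t on 𝐛(t); no property of P is
-- needed.

module _ {c ℓ : Level} (R : CommutativeRing c ℓ) where
  open CommutativeRing R hiding (zero)

  Σ-cong : ∀ {m} {f g : Fin m → Carrier} → (∀ i → f i ≈ g i) → Σ R f ≈ Σ R g
  Σ-cong {zero} f≈g = refl
  Σ-cong {suc m} f≈g = +-cong (f≈g Fin.zero) (Σ-cong (λ i → f≈g (Fin.suc i)))

  module _ {n : ℕ} (P : Event n → Event n → Carrier) where

    -- The summand of 𝐄on is local to its definition; unification names it here.
    𝐄on-summand : (World n → Carrier) → Event n → World n → Carrier
    𝐄on-summand f b = proj₁ {B = λ F → Σ R F ≡ 𝐄on R P f b} (_ , ≡.refl)

    𝐄on-summand-cong : ∀ {f g} b → (∀ v → v ∈ b → f v ≈ g v) →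
                       ∀ v → 𝐄on-summand f b v ≈ 𝐄on-summand g b v
    𝐄on-summand-cong b f≈g v with v ∈? b
    ... | yes v∈b = *-congʳ (f≈g v v∈b)
    ... | no _    = refl

    𝐄on-cong : ∀ {f g} b → (∀ v → v ∈ b → f v ≈ g v) → 𝐄on R P f b ≈ 𝐄on R P g b
    𝐄on-cong b f≈g = Σ-cong (𝐄on-summand-cong b f≈g)

    𝐄-reduct : Term n → World n → Carrier
    𝐄-reduct t v = 𝐄 R P (Xf R P (count t) (reduct v t)) (𝐛 (reduct v t))

    X-unfold-∈ : ∀ t {w v} → w ∉ 𝐛 t → v ∈ 𝐛 t → X R P t v ≡ 𝐄-reduct t v
    X-unfold-∈ 𝟘 w∉ _ = contradiction ∈⊤ w∉
    X-unfold-∈ 𝟙 w∉ _ = contradiction ∈⊤ w∉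
    X-unfold-∈ (cond a b p) {v = v} _ v∈ rewrite proj₂ (dec-yes (v ∈? b) v∈) = ≡.refl
    X-unfold-∈ (¬ᵗ t) {v = v} _ v∈ rewrite proj₂ (dec-yes (v ∈? 𝐛 (¬ᵗ t)) v∈) = ≡.refl
    X-unfold-∈ (t ∧ᵗ s) {v = v} _ v∈ rewrite proj₂ (dec-yes (v ∈? 𝐛 (t ∧ᵗ s)) v∈) = ≡.refl
    X-unfold-∈ (t ∨ᵗ s) {v = v} _ v∈ rewrite proj₂ (dec-yes (v ∈? 𝐛 (t ∨ᵗ s)) v∈) = ≡.refl

    X-unfold-∉ : ∀ t {w} → w ∉ 𝐛 t → X R P t w ≡ 𝐄on R P (𝐄-reduct t) (𝐛 t)
    X-unfold-∉ 𝟘 w∉ = contradiction ∈⊤ w∉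
    X-unfold-∉ 𝟙 w∉ = contradiction ∈⊤ w∉
    X-unfold-∉ (cond a b p) {w} w∉ rewrite dec-no (w ∈? b) w∉ = ≡.refl
    X-unfold-∉ (¬ᵗ t) {w} w∉ rewrite dec-no (w ∈? 𝐛 (¬ᵗ t)) w∉ = ≡.refl
    X-unfold-∉ (t ∧ᵗ s) {w} w∉ rewrite dec-no (w ∈? 𝐛 (t ∧ᵗ s)) w∉ = ≡.refl
    X-unfold-∉ (t ∨ᵗ s) {w} w∉ rewrite dec-no (w ∈? 𝐛 (t ∨ᵗ s)) w∉ = ≡.refl

    X-outside-𝐛 : ∀ t {w} → w ∉ 𝐛 t → X R P t w ≈ 𝐄on R P (X R P t) (𝐛 t)
    X-outside-𝐛 t w∉ = begin
      X R P t _                   ≡⟨ X-unfold-∉ t w∉ ⟩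
      𝐄on R P (𝐄-reduct t) (𝐛 t) ≈⟨ 𝐄on-cong (𝐛 t) (λ v v∈ → reflexive (X-unfold-∈ t w∉ v∈)) ⟨
      𝐄on R P (X R P t) (𝐛 t)     ∎
      where open SetoidReasoning setoid

lemma4p1 : {c ℓ ℓ' : Level} (R : CommutativeRing c ℓ)
           (_≤_ : CommutativeRing.Carrier R → CommutativeRing.Carrier R → Set ℓ')
           {n : ℕ} (P : Event n → Event n → CommutativeRing.Carrier R) →
           IsConditionalProbability R _≤_ P →
           (t t' : Term n) →
           𝐛 t ≡ 𝐛 t' →
           (∀ (w : World n) → w ∈ 𝐛 t → CommutativeRing._≈_ R (X R P t w) (X R P t' w)) →
           ∀ (w : World n) → CommutativeRing._≈_ R (X R P t w) (X R P t' w)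
lemma4p1 R _ P _ t t' 𝐛t≡𝐛t' agree w with w ∈? 𝐛 t
... | yes w∈ = agree w w∈
... | no w∉ = begin
  X R P t w                 ≈⟨ X-outside-𝐛 R P t w∉ ⟩
  𝐄on R P (X R P t) (𝐛 t)   ≈⟨ 𝐄on-cong R P (𝐛 t) agree ⟩
  𝐄on R P (X R P t') (𝐛 t)  ≡⟨ ≡.cong (𝐄on R P (X R P t')) 𝐛t≡𝐛t' ⟩
  𝐄on R P (X R P t') (𝐛 t') ≈⟨ X-outside-𝐛 R P t' (≡.subst (w ∉_) 𝐛t≡𝐛t' w∉) ⟨
  X R P t' w                ∎
  where open SetoidReasoning (CommutativeRing.setoid R)
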